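{- Let $m\ge2$ be even and let $a_1,\dots,a_m\ge2$ be integers. Let $\mathcal{O}=\min\{a_1,a_3,\dots,a_{m-1}\}$ and $\mathcal{E}=\min\{a_2,a_4,\dots,a_m\}$. Then \[R_{C_m}(a_1,a_2,\dots,a_m)=R_{C_m}(\mathcal{O},\mathcal{E},\mathcal{O},\mathcal{E},\dots,\mathcal{O},\mathcal{E}).\]
   Context: $C_m\le S_m$ denotes the cyclic group generated by the $m$-cycle $(1\,2\,\cdots\,m)$. An $m$-edge-coloured complete graph is a complete graph with each edge coloured from $[m]=\{1,\dots,m\}$. For $\Gamma\le S_m$, $\pi\in\Gamma$ and a vertex $v$, switching at $v$ with $\pi$ recolours every edge incident with $v$ of colour $i$ to colour $\pi(i)$, leaving other edges unchanged. Two such graphs on the same vertex set are $\Gamma$-switch equivalent if one is obtained from the other by a finite sequence of switches. $K_t^{(i)}$ is a complete graph on $t$ vertices with all edges of colour $i$. $R_\Gamma(a_1,\dots,a_m)$ is the least $n$ such that every $m$-edge-coloured complete graph on $n$ vertices is $\Gamma$-switch equivalent to one containing, for some $i$, a copy of $K_{a_i}^{(i)}$. -}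

module Defs where

open import Data.Nat using (ℕ; zero; suc; _≤_; _%_)
open import Data.Nat.DivMod using (_mod_)
open import Data.Fin using (Fin; toℕ; _≟_)
open import Data.Bool using (Bool; if_then_else_; _xor_)
open import Data.Product using (Σ; ∃; ∃-syntax; _×_; _,_)
open import Function.Definitions using (Injective)
open import Relation.Nullary using (¬_; does)
open import Relation.Binary.PropositionalEquality using (_≡_)
open import Relation.Binary.Construct.Closure.ReflexiveTransitive using (Star)

-- Colours are Fin m; paper colour i ∈ [m] corresponds to Fin element i-1.

σ : ∀ {m} → Fin m → Fin m
σ {suc n} i = suc (toℕ i) mod suc n

-- σ^k; the elements of C_m are exactly the σ^k, k ∈ ℕ.
σ^ : ∀ {m} → ℕ → Fin m → Fin m
σ^ zero    i = i
σ^ (suc k) i = σ (σ^ k i)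

-- An m-edge-colouring of the complete graph on vertex set Fin n
-- (only off-diagonal values matter; symmetry is required separately).
Colouring : ℕ → ℕ → Set
Colouring n m = Fin n → Fin n → Fin m

SymmetricCol : ∀ {n m} → Colouring n m → Set
SymmetricCol {n} c = ∀ (x y : Fin n) → c x y ≡ c y x

switch : ∀ {n m} → Fin n → ℕ → Colouring n m → Colouring n m
switch v k c x y =
  if does (x ≟ v) xor does (y ≟ v) then σ^ k (c x y) else c x y

data Switch {n m : ℕ} : Colouring n m → Colouring n m → Set where
  sw : ∀ (v : Fin n) (k : ℕ) (c : Colouring n m) → Switch c (switch v k c)

SwitchEq : ∀ {n m} → Colouring n m → Colouring n m → Set
SwitchEq = Star Switch

HasMonoClique : ∀ {n m} → Colouring n m → ℕ → Fin m → Set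
HasMonoClique {n} c t i =
  Σ (Fin t → Fin n) λ f → (Injective _≡_ _≡_ f ×
          (∀ (x y : Fin t) → ¬ x ≡ y → c (f x) (f y) ≡ i))

Arrows : (m : ℕ) → (Fin m → ℕ) → ℕ → Set
Arrows m a n =
  ∀ (c : Colouring n m) → SymmetricCol c →
  ∃[ c' ] (SwitchEq c c' × ∃[ i ] HasMonoClique c' (a i) i)

IsLeast : (ℕ → Set) → ℕ → Set
IsLeast P r = P r × (∀ k → P k → r ≤ k)

RamseyCm≡ : (m : ℕ) → (Fin m → ℕ) → ℕ → Set
RamseyCm≡ m a r = IsLeast (Arrows m a) r

IsMinOn : ∀ {m} → (Fin m → ℕ) → (Fin m → Set) → ℕ → Set
IsMinOn {m} a p o = (∃[ j ] (p j × a j ≡ o)) × (∀ (j : Fin m) → p j → o ≤ a j)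

-- paper colour toℕ j + 1 is odd
OddColour : ∀ {m} → Fin m → Set
OddColour j = toℕ j % 2 ≡ 0

EvenColour : ∀ {m} → Fin m → Set
EvenColour j = toℕ j % 2 ≡ 1

alternating : ∀ {m} → ℕ → ℕ → Fin m → ℕ
alternating O E j = if does (toℕ j % 2 Data.Nat.≟ 0) then O else E

-- Since C_m is abelian, a sequence of switches acts only through the total exponent K(u) of
-- the switches at each vertex u: it recolours the edge uw from i to σ^(K(u)+K(w)) i.  Switching
-- every vertex with σ^s therefore adds 2s to every colour, and for even m this moves any colour
-- to any other colour of the same parity.  So a switchable K_t^(i) yields a switchable K_t^(j)
-- for every j of the parity of i, and the property "every colouring of K_n switches to one
-- containing some K_(a_i)^(i)" is the same for a and for (O, E, ..., O, E).  The least such n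
-- exists: Ramsey's theorem bounds it, and the property is decidable because the exponents K(u)
-- only matter modulo m.
module Submission where

open import Defs
open import Data.Bool using (true; false; if_then_else_)
open import Data.Empty using (⊥-elim)
open import Data.Fin as Fin using (Fin; zero; suc; toℕ; inject≤; _≟_)
open import Data.Fin.Properties
  using (toℕ-injective; toℕ<n; toℕ-fromℕ<; inject≤-injective; any?; all?; <-cmp)
open import Data.List using (List; []; _∷_; length; filter; allFin)
open import Data.List.Properties using (length-tabulate)
open import Data.List.Relation.Unary.All as All using (All; []; _∷_)
open import Data.List.Relation.Unary.All.Properties
  using (all-filter) renaming (filter⁺ to All-filter⁺)
open import Data.List.Relation.Unary.AllPairs using (AllPairs; []; _∷_)
open import Data.List.Relation.Unary.AllPairs.Properties
  using () renaming (filter⁺ to AllPairs-filter⁺)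
open import Data.List.Relation.Unary.Unique.Propositional using (Unique)
open import Data.List.Relation.Unary.Unique.Propositional.Properties using (allFin⁺)
open import Data.Nat as ℕ using (ℕ; zero; suc; _+_; _*_; _∸_; _≤_; _<_; _%_; _/_; z≤n; s≤s)
open import Data.Nat.DivMod
  using (_mod_; m%n<n; %-distribˡ-+; m%n%n≡m%n; m<n⇒m%n≡m; [m+n]%n≡m%n; m≡m%n+[m/n]*n; /-monoˡ-≤)
open import Data.Nat.Induction using (<-rec)
open import Data.Nat.Properties hiding (_≟_; <-cmp)
open import Data.Nat.Solver using (module +-*-Solver)
open import Algebra.Properties.CommutativeMonoid.Sum +-0-commutativeMonoid
  using (sum-syntax; sum-cong-≗; sum-replicate-zero; ∑-distrib-+)
open import Data.Product using (Σ; ∃; ∃-syntax; _×_; _,_; proj₁; proj₂)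
open import Data.Sum using (_⊎_; inj₁; inj₂)
open import Data.Unit using (⊤; tt)
open import Data.Vec.Functional using (head; tail) renaming (_∷_ to _◂_)
open import Data.Vec.Functional.Relation.Binary.Pointwise using (Pointwise)
open import Function using (_∘_; id; _⇔_; mk⇔; Equivalence)
open import Function.Definitions using (Injective)
open import Level using (0ℓ)
open import Relation.Binary using (Rel; Reflexive; Symmetric; _Respects_; tri<; tri≈; tri>)
open import Relation.Binary.Construct.Closure.ReflexiveTransitive using (ε; _◅_)
open import Relation.Binary.PropositionalEquality
  using (_≡_; _≢_; refl; sym; trans; cong; cong₂; subst; _≗_; module ≡-Reasoning)
open import Relation.Nullary using (Dec; yes; no; ¬?; does)
open import Relation.Nullary.Decidable using (_×-dec_; _→-dec_; decidable-stable; map′)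
open import Relation.Unary using (Pred; Decidable)

open Equivalence using (to; from)

-- Arithmetic of the rotation σ

[m+n%d]%d≡[m+n]%d : ∀ m n d .{{_ : ℕ.NonZero d}} → (m + n % d) % d ≡ (m + n) % d
[m+n%d]%d≡[m+n]%d m n d = begin
  (m + n % d) % d          ≡⟨ %-distribˡ-+ m (n % d) d ⟩
  (m % d + n % d % d) % d  ≡⟨ cong (λ k → (m % d + k) % d) (m%n%n≡m%n n d) ⟩
  (m % d + n % d) % d      ≡⟨ %-distribˡ-+ m n d ⟨
  (m + n) % d              ∎
  where open ≡-Reasoning

even-gap : ∀ {n x y} → n % 2 ≡ 0 → x % 2 ≡ y % 2 → x < n → ∃[ s ] x + (s + s) ≡ y + n
even-gap {n} {x} {y} n-even x≡y x<n = s , (begin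
  x + (s + s)                         ≡⟨ cong (_+ (s + s)) x≡ ⟩
  r + qx * 2 + ((d + qy) + (d + qy))  ≡⟨ regroup r qx d qy ⟩
  (r + qy * 2) + (qx + d) * 2         ≡⟨ cong₂ (λ k l → k + l * 2) (sym y≡) (m+[n∸m]≡n qx≤p) ⟩
  y + p * 2                           ≡⟨ cong (y +_) n≡ ⟨
  y + n                               ∎)
  where
  open ≡-Reasoning
  open +-*-Solver
  r qx qy p d s : ℕ
  r = x % 2 ; qx = x / 2 ; qy = y / 2 ; p = n / 2
  d = p ∸ qx
  s = d + qy
  x≡ : x ≡ r + qx * 2
  x≡ = m≡m%n+[m/n]*n x 2
  y≡ : y ≡ r + qy * 2
  y≡ = trans (m≡m%n+[m/n]*n y 2) (cong (_+ qy * 2) (sym x≡y))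
  n≡ : n ≡ p * 2
  n≡ = trans (m≡m%n+[m/n]*n n 2) (cong (_+ p * 2) n-even)
  qx≤p : qx ≤ p
  qx≤p = /-monoˡ-≤ 2 (<⇒≤ x<n)
  regroup : ∀ r qx d qy → r + qx * 2 + ((d + qy) + (d + qy)) ≡ (r + qy * 2) + (qx + d) * 2
  regroup = solve 4 (λ r qx d qy → r :+ qx :* con 2 :+ ((d :+ qy) :+ (d :+ qy))
                                   := (r :+ qy :* con 2) :+ (qx :+ d) :* con 2) refl

σ^-+ : ∀ {m} d e (i : Fin m) → σ^ d (σ^ e i) ≡ σ^ (d + e) i
σ^-+ zero    e i = refl
σ^-+ (suc d) e i = cong σ (σ^-+ d e i)

toℕ-σ^ : ∀ {m} d (i : Fin (suc m)) → toℕ (σ^ d i) ≡ (toℕ i + d) % suc m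
toℕ-σ^ {m} zero i = begin
  toℕ i                ≡⟨ m<n⇒m%n≡m (toℕ<n i) ⟨
  toℕ i % suc m        ≡⟨ cong (_% suc m) (+-identityʳ (toℕ i)) ⟨
  (toℕ i + 0) % suc m  ∎
  where open ≡-Reasoning
toℕ-σ^ {m} (suc d) i = begin
  toℕ (σ (σ^ d i))                   ≡⟨ toℕ-fromℕ< (m%n<n (suc (toℕ (σ^ d i))) (suc m)) ⟩
  (1 + toℕ (σ^ d i)) % suc m         ≡⟨ cong (λ k → (1 + k) % suc m) (toℕ-σ^ d i) ⟩
  (1 + (toℕ i + d) % suc m) % suc m  ≡⟨ [m+n%d]%d≡[m+n]%d 1 (toℕ i + d) (suc m) ⟩
  (1 + (toℕ i + d)) % suc m          ≡⟨ cong (_% suc m) (+-suc (toℕ i) d) ⟨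
  (toℕ i + suc d) % suc m            ∎
  where open ≡-Reasoning

σ^-cong-% : ∀ {m} d e (i : Fin (suc m)) → d % suc m ≡ e % suc m → σ^ d i ≡ σ^ e i
σ^-cong-% {m} d e i d≡e = toℕ-injective (begin
  toℕ (σ^ d i)                 ≡⟨ toℕ-σ^ d i ⟩
  (toℕ i + d) % suc m          ≡⟨ [m+n%d]%d≡[m+n]%d (toℕ i) d (suc m) ⟨
  (toℕ i + d % suc m) % suc m  ≡⟨ cong (λ k → (toℕ i + k) % suc m) d≡e ⟩
  (toℕ i + e % suc m) % suc m  ≡⟨ [m+n%d]%d≡[m+n]%d (toℕ i) e (suc m) ⟩
  (toℕ i + e) % suc m          ≡⟨ toℕ-σ^ e i ⟨
  toℕ (σ^ e i)                 ∎)
  where open ≡-Reasoning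

sameParity⇒σ^-double : ∀ {m} → suc m % 2 ≡ 0 → (i j : Fin (suc m)) → toℕ i % 2 ≡ toℕ j % 2 →
  ∃[ s ] σ^ (s + s) i ≡ j
sameParity⇒σ^-double {m} m-even i j i≡j =
  let s , gap = even-gap {y = toℕ j} m-even i≡j (toℕ<n i) in
  s , toℕ-injective (begin
    toℕ (σ^ (s + s) i)         ≡⟨ toℕ-σ^ (s + s) i ⟩
    (toℕ i + (s + s)) % suc m  ≡⟨ cong (_% suc m) gap ⟩
    (toℕ j + suc m) % suc m    ≡⟨ [m+n]%n≡m%n (toℕ j) (suc m) ⟩
    toℕ j % suc m              ≡⟨ m<n⇒m%n≡m (toℕ<n j) ⟩
    toℕ j                      ∎)
  where open ≡-Reasoning

-- Switching classes

infix 4 _≗ᴱ_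
_≗ᴱ_ : ∀ {n m} → Colouring n m → Colouring n m → Set
c ≗ᴱ d = ∀ x y → x ≢ y → c x y ≡ d x y

switchAll : ∀ {n m} → (Fin n → ℕ) → Colouring n m → Colouring n m
switchAll K c x y = σ^ (K x + K y) (c x y)

δ : ∀ {n} → Fin n × ℕ → Fin n → ℕ
δ (v , k) u = if does (u ≟ v) then k else 0

switch≗ᴱswitchAll : ∀ {n m} v k (c : Colouring n m) → switch v k c ≗ᴱ switchAll (δ (v , k)) c
switch≗ᴱswitchAll v k c x y x≢y with x ≟ v | y ≟ v
... | yes refl | yes refl = ⊥-elim (x≢y refl)
... | yes _    | no _     = cong (λ e → σ^ e (c x y)) (sym (+-identityʳ k))
... | no _     | yes _    = refl
... | no _     | no _     = refl

switchAll-switchAll : ∀ {n m} (K L : Fin n → ℕ) (c : Colouring n m) x y →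
  switchAll K (switchAll L c) x y ≡ switchAll (λ u → L u + K u) c x y
switchAll-switchAll K L c x y = trans (σ^-+ (K x + K y) (L x + L y) (c x y))
  (cong (λ e → σ^ e (c x y)) (regroup (K x) (K y) (L x) (L y)))
  where
  open +-*-Solver
  regroup : ∀ kx ky lx ly → (kx + ky) + (lx + ly) ≡ (lx + kx) + (ly + ky)
  regroup = solve 4 (λ kx ky lx ly → (kx :+ ky) :+ (lx :+ ly) := (lx :+ kx) :+ (ly :+ ky)) refl

switchAll-resp : ∀ {n m} K {c d : Colouring n m} → c ≗ᴱ d → switchAll K c ≗ᴱ switchAll K d
switchAll-resp K c≗d x y x≢y = cong (σ^ (K x + K y)) (c≗d x y x≢y)

switchAll-cong : ∀ {n m} {K L : Fin n → ℕ} (c : Colouring n m) → K ≗ L →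
  ∀ x y → switchAll K c x y ≡ switchAll L c x y
switchAll-cong c K≗L x y = cong₂ (λ kx ky → σ^ (kx + ky) (c x y)) (K≗L x) (K≗L y)

SwitchEq⇒switchAll : ∀ {n m} {c c' : Colouring n m} → SwitchEq c c' → ∃[ K ] c' ≗ᴱ switchAll K c
SwitchEq⇒switchAll ε = (λ _ → 0) , λ _ _ _ → refl
SwitchEq⇒switchAll {c' = c'} (sw v k c ◅ switches) =
  let K , c'≗ = SwitchEq⇒switchAll switches in
  (λ u → δ (v , k) u + K u) , λ x y x≢y → begin
    c' x y                                     ≡⟨ c'≗ x y x≢y ⟩
    switchAll K (switch v k c) x y             ≡⟨ switchAll-resp K (switch≗ᴱswitchAll v k c) x y x≢y ⟩
    switchAll K (switchAll (δ (v , k)) c) x y  ≡⟨ switchAll-switchAll K (δ (v , k)) c x y ⟩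
    switchAll (λ u → δ (v , k) u + K u) c x y  ∎
  where open ≡-Reasoning

potential : ∀ {n k} → (Fin k → Fin n × ℕ) → Fin n → ℕ
potential {k = k} s u = ∑[ j < k ] δ (s j) u

potential-diagonal : ∀ {n} (K : Fin n → ℕ) → potential (λ v → v , K v) ≗ K
potential-diagonal {suc n} K zero    = trans (cong (K zero +_) (sum-replicate-zero n)) (+-identityʳ _)
potential-diagonal {suc n} K (suc u) = potential-diagonal (K ∘ suc) u

switches-reach : ∀ {n m k} (s : Fin k → Fin n × ℕ) (c : Colouring n m) →
  ∃[ c' ] SwitchEq c c' × c' ≗ᴱ switchAll (potential s) c
switches-reach {k = zero}  s c = c , ε , λ _ _ _ → refl
switches-reach {k = suc _} s c =
  let v , l = s zero
      c' , c→′c' , c'≗ = switches-reach (s ∘ suc) (switch v l c)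
      P = potential (s ∘ suc)
  in c' , sw v l c ◅ c→′c' , λ x y x≢y → begin
    c' x y                                    ≡⟨ c'≗ x y x≢y ⟩
    switchAll P (switch v l c) x y            ≡⟨ switchAll-resp P (switch≗ᴱswitchAll v l c) x y x≢y ⟩
    switchAll P (switchAll (δ (v , l)) c) x y ≡⟨ switchAll-switchAll P (δ (v , l)) c x y ⟩
    switchAll (potential s) c x y             ∎
  where open ≡-Reasoning

switchAll⇒SwitchEq : ∀ {n m} (K : Fin n → ℕ) (c : Colouring n m) →
  ∃[ c' ] SwitchEq c c' × c' ≗ᴱ switchAll K c
switchAll⇒SwitchEq K c =
  let c' , c→c' , c'≗ = switches-reach (λ v → v , K v) c in
  c' , c→c' , λ x y x≢y → trans (c'≗ x y x≢y) (switchAll-cong c (potential-diagonal K) x y)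

HasMonoClique-resp : ∀ {n m} {c d : Colouring n m} → c ≗ᴱ d → ∀ {t i} →
  HasMonoClique c t i → HasMonoClique d t i
HasMonoClique-resp c≗d (f , f-injective , mono) =
  f , f-injective , λ x y x≢y → trans (sym (c≗d (f x) (f y) (x≢y ∘ f-injective))) (mono x y x≢y)

HasMonoClique-map : ∀ {n m} (g : Fin m → Fin m) {c : Colouring n m} {t i} →
  HasMonoClique c t i → HasMonoClique (λ x y → g (c x y)) t (g i)
HasMonoClique-map g (f , f-injective , mono) = f , f-injective , λ x y x≢y → cong g (mono x y x≢y)

HasMonoClique-≤ : ∀ {n m} {c : Colouring n m} {s t i} → s ≤ t →
  HasMonoClique c t i → HasMonoClique c s i
HasMonoClique-≤ {s = s} {t} s≤t (f , f-injective , mono) =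
  f ∘ embed , embed-injective ∘ f-injective , λ x y x≢y → mono _ _ (x≢y ∘ embed-injective)
  where
  embed : Fin s → Fin t
  embed x = inject≤ x s≤t
  embed-injective : ∀ {x y} → embed x ≡ embed y → x ≡ y
  embed-injective = inject≤-injective s≤t s≤t _ _

SwitchesToClique : ∀ {n m} → (Fin m → ℕ) → Colouring n m → Set
SwitchesToClique a c = ∃[ K ] ∃[ i ] HasMonoClique (switchAll K c) (a i) i

switchEq⇔SwitchesToClique : ∀ {n m} {a : Fin m → ℕ} {c : Colouring n m} →
  (∃[ c' ] SwitchEq c c' × ∃[ i ] HasMonoClique c' (a i) i) ⇔ SwitchesToClique a c
switchEq⇔SwitchesToClique = mk⇔
  (λ (c' , c→c' , i , clique) →
    let K , c'≗ = SwitchEq⇒switchAll c→c' in K , i , HasMonoClique-resp c'≗ clique)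
  (λ (K , i , clique) →
    let c' , c→c' , c'≗ = switchAll⇒SwitchEq K _ in
    c' , c→c' , i , HasMonoClique-resp (λ x y x≢y → sym (c'≗ x y x≢y)) clique)

Arrows⇔ : ∀ {m a n} → Arrows m a n ⇔ (∀ (c : Colouring n m) → SymmetricCol c → SwitchesToClique a c)
Arrows⇔ = mk⇔ (λ arrows c c-sym → to switchEq⇔SwitchesToClique (arrows c c-sym))
              (λ switchable c c-sym → from switchEq⇔SwitchesToClique (switchable c c-sym))

-- σ^ (s + s) is the recolouring caused by switching every vertex with σ^ s.
_≼_ : ∀ {m} → (Fin m → ℕ) → (Fin m → ℕ) → Set
a ≼ b = ∀ i → ∃[ j ] ∃[ s ] σ^ (s + s) i ≡ j × a j ≤ b i

SwitchesToClique-antitone : ∀ {n m} {a b : Fin m → ℕ} {c : Colouring n m} →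
  a ≼ b → SwitchesToClique b c → SwitchesToClique a c
SwitchesToClique-antitone {n} {m} {b = b} {c} a≼b (K , i , clique) =
  let j , s , i↦j , aj≤bi = a≼b i in
  (λ u → K u + s) , j ,
  HasMonoClique-≤ {c = shift s} aj≤bi (subst (HasMonoClique (shift s) (b i)) i↦j (shifted s))
  where
  shift : ℕ → Colouring n m
  shift s = switchAll (λ u → K u + s) c
  shifted : ∀ s → HasMonoClique (shift s) (b i) (σ^ (s + s) i)
  shifted s = HasMonoClique-resp (λ x y _ → switchAll-switchAll (λ _ → s) K c x y)
                                 (HasMonoClique-map (σ^ (s + s)) {switchAll K c} clique)

Arrows-antitone : ∀ {m n} {a b : Fin m → ℕ} → a ≼ b → Arrows m b n → Arrows m a n
Arrows-antitone a≼b arrows =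
  from Arrows⇔ λ c c-sym → SwitchesToClique-antitone {c = c} a≼b (to Arrows⇔ arrows c c-sym)

-- Deciding the arrow relation

-- Predicates must respect _≈_ because, without function extensionality, searching a function
-- space only finds witnesses up to pointwise equality.
Exhaustible : (A : Set) → Rel A 0ℓ → Set₁
Exhaustible A _≈_ = ∀ {P : Pred A 0ℓ} → P Respects _≈_ → Decidable P → Dec (∃ P)

Fin-exhaustible : ∀ {k} → Exhaustible (Fin k) _≡_
Fin-exhaustible _ = any?

→-exhaustible : ∀ {A : Set} {_≈_ : Rel A 0ℓ} → Reflexive _≈_ → Exhaustible A _≈_ →
  ∀ k → Exhaustible (Fin k → A) (Pointwise _≈_)
→-exhaustible {A} ≈-refl search zero {P} resp P? =
  map′ (empty ,_) (λ (f , p) → resp {f} (λ ()) p) (P? empty)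
  where
  empty : Fin 0 → A
  empty ()
→-exhaustible {A} ≈-refl search (suc k) {P} resp P? =
  map′ (λ (a , g , p) → a ◂ g , p)
       (λ (f , p) → head f , tail f , resp (λ { zero → ≈-refl ; (suc _) → ≈-refl }) p)
       (search (λ a≈b (g , p) → g , resp (λ { zero → a≈b ; (suc _) → ≈-refl }) p) extends?)
  where
  extends? : Decidable (λ a → ∃ λ g → P (a ◂ g))
  extends? a = →-exhaustible ≈-refl search k
    (λ g≈h → resp (λ { zero → ≈-refl ; (suc i) → g≈h i })) (λ g → P? (a ◂ g))

exhaustible⇒∀? : ∀ {A : Set} {_≈_ : Rel A 0ℓ} → Symmetric _≈_ → Exhaustible A _≈_ →
  {P : Pred A 0ℓ} → P Respects _≈_ → Decidable P → Dec (∀ x → P x)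
exhaustible⇒∀? ≈-sym search resp P?
  with search (λ x≈y ¬px py → ¬px (resp (≈-sym x≈y) py)) (¬? ∘ P?)
... | yes (x , ¬px) = no λ ∀p → ¬px (∀p x)
... | no ∄¬p        = yes λ x → decidable-stable (P? x) λ ¬px → ∄¬p (x , ¬px)

Colouring-exhaustible : ∀ {n m} → Exhaustible (Colouring n m) (Pointwise (Pointwise _≡_))
Colouring-exhaustible {n} = →-exhaustible (λ _ → refl) (→-exhaustible refl Fin-exhaustible n) n

Injective? : ∀ {t n} (f : Fin t → Fin n) → Dec (Injective _≡_ _≡_ f)
Injective? f = map′ (λ inj {x} {y} → inj x y) (λ inj x y → inj)
  (all? λ x → all? λ y → f x ≟ f y →-dec x ≟ y)

HasMonoClique? : ∀ {n m} (c : Colouring n m) t i → Dec (HasMonoClique c t i)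
HasMonoClique? {n} c t i = →-exhaustible refl Fin-exhaustible t resp
  (λ f → Injective? f ×-dec (all? λ x → all? λ y → ¬? (x ≟ y) →-dec c (f x) (f y) ≟ i))
  where
  IsMonoClique : Pred (Fin t → Fin n) 0ℓ
  IsMonoClique f = Injective _≡_ _≡_ f × (∀ x y → x ≢ y → c (f x) (f y) ≡ i)
  resp : IsMonoClique Respects Pointwise _≡_
  resp f≗g (f-injective , mono) =
    (λ e → f-injective (trans (f≗g _) (trans e (sym (f≗g _))))) ,
    λ x y x≢y → trans (cong₂ c (sym (f≗g x)) (sym (f≗g y))) (mono x y x≢y)

switchAll-mod : ∀ {n m} (K : Fin n → ℕ) (c : Colouring n (suc m)) x y →
  switchAll K c x y ≡ switchAll (λ u → toℕ (K u mod suc m)) c x y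
switchAll-mod {n} {m} K c x y = σ^-cong-% (K x + K y) (K′ x + K′ y) (c x y) (begin
  (K x + K y) % suc m                  ≡⟨ %-distribˡ-+ (K x) (K y) (suc m) ⟩
  (K x % suc m + K y % suc m) % suc m  ≡⟨ cong₂ (λ p q → (p + q) % suc m) (K′≡ x) (K′≡ y) ⟨
  (K′ x + K′ y) % suc m                ∎)
  where
  open ≡-Reasoning
  K′ : Fin n → ℕ
  K′ u = toℕ (K u mod suc m)
  K′≡ : ∀ u → K′ u ≡ K u % suc m
  K′≡ u = toℕ-fromℕ< (m%n<n (K u) (suc m))

SwitchesToClique? : ∀ {n m} (a : Fin (suc m) → ℕ) (c : Colouring n (suc m)) →
  Dec (SwitchesToClique a c)
SwitchesToClique? {n} {m} a c =
  map′ (λ (K , i , clique) → toℕ ∘ K , i , clique) reduce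
       (→-exhaustible refl Fin-exhaustible n resp
         λ K → any? λ i → HasMonoClique? (switchAll (toℕ ∘ K) c) (a i) i)
  where
  SwitchesBoundedToClique : Pred (Fin n → Fin (suc m)) 0ℓ
  SwitchesBoundedToClique K = ∃[ i ] HasMonoClique (switchAll (toℕ ∘ K) c) (a i) i
  resp : SwitchesBoundedToClique Respects Pointwise _≡_
  resp K≗L (i , clique) =
    i , HasMonoClique-resp (λ x y _ → switchAll-cong c (cong toℕ ∘ K≗L) x y) clique
  reduce : SwitchesToClique a c → ∃ SwitchesBoundedToClique
  reduce (K , i , clique) =
    (λ u → K u mod suc m) , i , HasMonoClique-resp (λ x y _ → switchAll-mod K c x y) clique

Arrows? : ∀ {m} (a : Fin (suc m) → ℕ) n → Dec (Arrows (suc m) a n)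
Arrows? a n = map′ (from Arrows⇔) (to Arrows⇔)
  (exhaustible⇒∀? (λ c≈d x y → sym (c≈d x y)) Colouring-exhaustible resp
    λ c → (all? λ x → all? λ y → c x y ≟ c y x) →-dec SwitchesToClique? a c)
  where
  resp : ∀ {c d} → Pointwise (Pointwise _≡_) c d →
    (SymmetricCol c → SwitchesToClique a c) → SymmetricCol d → SwitchesToClique a d
  resp c≈d switchable d-sym =
    let c-sym x y = trans (c≈d x y) (trans (d-sym x y) (sym (c≈d y x)))
        K , i , clique = switchable c-sym
    in K , i , HasMonoClique-resp (switchAll-resp K λ x y _ → c≈d x y) clique

least-exists : ∀ {P : ℕ → Set} → Decidable P → ∀ {N} → P N → ∃[ r ] IsLeast P r
least-exists {P} P? {N} = <-rec (λ N → P N → ∃[ r ] IsLeast P r) search N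
  where
  search : ∀ N → (∀ {M} → M < N → P M → ∃[ r ] IsLeast P r) → P N → ∃[ r ] IsLeast P r
  search N below pN with anyUpTo? P? N
  ... | yes (M , M<N , pM) = below M<N pM
  ... | no ∄below          = N , pN , λ k pk → ≮⇒≥ λ k<N → ∄below (k , k<N , pk)

IsLeast-cong : ∀ {P Q : ℕ → Set} → (∀ n → P n ⇔ Q n) → ∀ {r} → IsLeast P r → IsLeast Q r
IsLeast-cong P⇔Q (pr , least) = to (P⇔Q _) pr , λ k qk → least k (from (P⇔Q k) qk)

-- Ramsey's theorem

length-filter-∷ : ∀ {A : Set} {P : Pred A 0ℓ} (P? : Decidable P) x xs →
  length (filter P? (x ∷ xs)) ≡ (if does (P? x) then 1 else 0) + length (filter P? xs)
length-filter-∷ P? x xs with does (P? x)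
... | true  = refl
... | false = refl

∑-indicator : ∀ {k} (i : Fin k) → ∑[ j < k ] (if does (i ≟ j) then 1 else 0) ≡ 1
∑-indicator {suc k} zero    = cong suc (sum-replicate-zero k)
∑-indicator {suc k} (suc i) = ∑-indicator i

length≡∑-classes : ∀ {A : Set} {k} (g : A → Fin k) xs →
  length xs ≡ ∑[ j < k ] length (filter (λ x → g x ≟ j) xs)
length≡∑-classes {k = k} g []       = sym (sum-replicate-zero k)
length≡∑-classes {A} {k} g (x ∷ xs) = begin
  1 + length xs
    ≡⟨ cong₂ _+_ (sym (∑-indicator (g x))) (length≡∑-classes g xs) ⟩
  ∑[ j < k ] [ g x ≡ j ] + ∑[ j < k ] length (class j xs)
    ≡⟨ ∑-distrib-+ (λ j → [ g x ≡ j ]) (λ j → length (class j xs)) ⟨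
  ∑[ j < k ] ([ g x ≡ j ] + length (class j xs))
    ≡⟨ sum-cong-≗ (λ j → length-filter-∷ (λ y → g y ≟ j) x xs) ⟨
  ∑[ j < k ] length (class j (x ∷ xs))
    ∎
  where
  open ≡-Reasoning
  [_≡_] : Fin k → Fin k → ℕ
  [ i ≡ j ] = if does (i ≟ j) then 1 else 0
  class : Fin k → List A → List A
  class j = filter (λ y → g y ≟ j)

∑-pigeonhole : ∀ {k} (b f : Fin (suc k) → ℕ) → ∑[ j < suc k ] b j ≤ ∑[ j < suc k ] f j →
  ∃[ j ] b j ≤ f j
∑-pigeonhole {zero}  b f ∑b≤∑f = zero , +-cancelʳ-≤ 0 (b zero) (f zero) ∑b≤∑f
∑-pigeonhole {suc k} b f ∑b≤∑f with b zero ≤? f zero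
... | yes b₀≤f₀ = zero , b₀≤f₀
... | no  b₀≰f₀ =
  let j , bj≤fj = ∑-pigeonhole (b ∘ suc) (f ∘ suc)
        (+-cancelˡ-≤ (b zero) _ _ (≤-trans ∑b≤∑f (+-monoˡ-≤ _ (≰⇒≥ b₀≰f₀))))
  in suc j , bj≤fj

pigeonhole : ∀ {A : Set} {k} (g : A → Fin (suc k)) (b : Fin (suc k) → ℕ) xs →
  ∑[ j < suc k ] b j ≤ length xs → ∃[ j ] b j ≤ length (filter (λ x → g x ≟ j) xs)
pigeonhole g b xs ∑b≤|xs| = ∑-pigeonhole b _ (subst (_ ≤_) (length≡∑-classes g xs) ∑b≤|xs|)

AllPairs⇒chain : ∀ {A : Set} {R : Rel A 0ℓ} {Q : Pred A 0ℓ} t {xs} → t ≤ length xs →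
  AllPairs R xs → All Q xs →
  Σ (Fin t → A) λ f → (∀ p q → p Fin.< q → R (f p) (f q)) × (∀ p → Q (f p))
AllPairs⇒chain zero    _       _          _          = (λ ()) , (λ ()) , (λ ())
AllPairs⇒chain (suc t) (s≤s t≤) (Rx ∷ Rxs) (Qx ∷ Qxs) =
  let f , chain , Qf = AllPairs⇒chain t t≤ Rxs (All.zip (Qxs , Rx)) in
  (_ ◂ f) ,
  (λ { zero (suc q) _ → proj₂ (Qf q) ; (suc p) (suc q) (s≤s p<q) → chain p q p<q }) ,
  (λ { zero → Qx ; (suc p) → proj₁ (Qf p) })

chain⇒HasMonoClique : ∀ {n m t i} {c : Colouring n m} → SymmetricCol c → (f : Fin t → Fin n) →
  (∀ p q → p Fin.< q → f p ≢ f q × c (f p) (f q) ≡ i) → HasMonoClique c t i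
chain⇒HasMonoClique {i = i} {c} c-sym f chain = f , injective , mono
  where
  injective : Injective _≡_ _≡_ f
  injective {p} {q} fp≡fq with <-cmp p q
  ... | tri< p<q _   _   = ⊥-elim (proj₁ (chain p q p<q) fp≡fq)
  ... | tri≈ _   p≡q _   = p≡q
  ... | tri> _   _   q<p = ⊥-elim (proj₁ (chain q p q<p) (sym fp≡fq))
  mono : ∀ p q → p ≢ q → c (f p) (f q) ≡ i
  mono p q p≢q with <-cmp p q
  ... | tri< p<q _   _   = proj₂ (chain p q p<q)
  ... | tri≈ _   p≡q _   = ⊥-elim (p≢q p≡q)
  ... | tri> _   _   q<p = trans (c-sym (f p) (f q)) (proj₂ (chain q p q<p))

-- ramseyBound m (1 + L) is 1 + (m + 1) · ramseyBound m L, written as a sum to match pigeonhole.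
ramseyBound : ℕ → ℕ → ℕ
ramseyBound m zero    = 0
ramseyBound m (suc L) = suc (∑[ _ < suc m ] ramseyBound m L)

module _ {n m} (c : Colouring n (suc m)) where

  Precedes : Rel (Fin n × Fin (suc m)) 0ℓ
  Precedes (u , i) (w , _) = u ≢ w × c u w ≡ i

  -- The head v gets the colour j of a pigeonhole-large class of its edges into the rest, and the
  -- construction recurses inside that class; Q carries v ≢ w and c v w ≡ j back out of the recursion.
  colourOrdered : ∀ L {Q : Pred (Fin n) 0ℓ} (V : List (Fin n)) → ramseyBound m L ≤ length V →
    Unique V → All Q V → ∃[ U ] L ≤ length U × AllPairs Precedes U × All (Q ∘ proj₁) U
  colourOrdered zero    V       _           _              _          = [] , z≤n , [] , []
  colourOrdered (suc L) {Q} (v ∷ T) (s≤s bound) (v∉T ∷ T-unique) (Qv ∷ QT) =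
    let j , large = pigeonhole (c v) (λ _ → ramseyBound m L) T bound
        T′ = filter (λ w → c v w ≟ j) T
        U , L≤|U| , U-ordered , QU = colourOrdered L {λ w → (Q w × v ≢ w) × c v w ≡ j} T′ large
          (AllPairs-filter⁺ _ T-unique)
          (All.zip (All.zip (All-filter⁺ _ QT , All-filter⁺ _ v∉T) , all-filter _ T))
    in (v , j) ∷ U , s≤s L≤|U| ,
       All.map (λ ((_ , v≢w) , cvw≡j) → v≢w , cvw≡j) QU ∷ U-ordered ,
       Qv ∷ All.map (proj₁ ∘ proj₁) QU

ramsey : ∀ {m} (a : Fin (suc m) → ℕ) →
  ∃[ N ] ∀ (c : Colouring N (suc m)) → SymmetricCol c → ∃[ i ] HasMonoClique c (a i) i
ramsey {m} a = N , λ c c-sym →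
  let U , ∑a≤|U| , U-ordered , _ = colourOrdered c (∑[ j < suc m ] a j) {λ _ → ⊤} (allFin N)
        (≤-reflexive (sym (length-tabulate id))) (allFin⁺ N) (All.universal (λ _ → tt) _)
      j , aj≤|class| = pigeonhole proj₂ a U ∑a≤|U|
      f , ordered , colour≡j = AllPairs⇒chain (a j) aj≤|class|
        (AllPairs-filter⁺ _ U-ordered) (all-filter (λ p → proj₂ p ≟ j) U)
  in j , chain⇒HasMonoClique c-sym (proj₁ ∘ f) λ p q p<q →
       proj₁ (ordered p q p<q) , trans (proj₂ (ordered p q p<q)) (colour≡j p)
  where
  N : ℕ
  N = ramseyBound m (∑[ j < suc m ] a j)

Arrows-exists : ∀ {m} (a : Fin (suc m) → ℕ) → ∃[ N ] Arrows (suc m) a N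
Arrows-exists a = let N , mono = ramsey a in N , λ c c-sym → c , ε , mono c c-sym

alternating-cases : ∀ {m} O E (i : Fin m) →
  (OddColour i × alternating O E i ≡ O) ⊎ (EvenColour i × alternating O E i ≡ E)
alternating-cases O E i with toℕ i % 2 | m%n<n (toℕ i) 2
... | zero        | _               = inj₁ (refl , refl)
... | suc zero    | _               = inj₂ (refl , refl)
... | suc (suc _) | s≤s (s≤s ())

alternating≼ : ∀ {m} {a : Fin m → ℕ} {O E} → IsMinOn a OddColour O → IsMinOn a EvenColour E →
  alternating O E ≼ a
alternating≼ {a = a} {O} {E} (_ , O-least) (_ , E-least) i with alternating-cases O E i
... | inj₁ (odd , alt≡O)  = i , 0 , refl , subst (_≤ a i) (sym alt≡O) (O-least i odd)
... | inj₂ (even , alt≡E) = i , 0 , refl , subst (_≤ a i) (sym alt≡E) (E-least i even)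

≼alternating : ∀ {m} {a : Fin (suc m) → ℕ} {O E} → suc m % 2 ≡ 0 →
  IsMinOn a OddColour O → IsMinOn a EvenColour E → a ≼ alternating O E
≼alternating {O = O} {E} m-even ((jO , odd-jO , a-jO) , _) ((jE , even-jE , a-jE) , _) i
  with alternating-cases O E i
... | inj₁ (odd , alt≡O) =
  let s , i↦jO = sameParity⇒σ^-double m-even i jO (trans odd (sym odd-jO)) in
  jO , s , i↦jO , ≤-reflexive (trans a-jO (sym alt≡O))
... | inj₂ (even , alt≡E) =
  let s , i↦jE = sameParity⇒σ^-double m-even i jE (trans even (sym even-jE)) in
  jE , s , i↦jE , ≤-reflexive (trans a-jE (sym alt≡E))

theorem19 : (m : ℕ) → 2 ≤ m → m % 2 ≡ 0 →
    (a : Fin m → ℕ) → (∀ i → 2 ≤ a i) →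
    (O E : ℕ) → IsMinOn a OddColour O → IsMinOn a EvenColour E →
    ∃[ r ] (RamseyCm≡ m a r × RamseyCm≡ m (alternating O E) r)
theorem19 (suc m) _ m-even a _ O E O-min E-min =
  let r , r-least = least-exists (Arrows? a) (proj₂ (Arrows-exists a)) in
  r , r-least , IsLeast-cong same-arrows r-least
  where
  same-arrows : ∀ n → Arrows (suc m) a n ⇔ Arrows (suc m) (alternating O E) n
  same-arrows _ = mk⇔ (Arrows-antitone (alternating≼ O-min E-min))
                      (Arrows-antitone (≼alternating m-even O-min E-min))
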